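{- Let $\Gamma$ be the directed graph whose vertices are the pairs $(n,k)$ with integers $n\ge k\ge 0$, and whose edges are, for every $n\ge k\ge 0$, an edge from $(n+1,k)$ to $(n+1,k+1)$ and an edge from $(n,n-k)$ to $(n+1,k+1)$. For $0\le i\le n$ and $0\le k\le n$, let $\pi(n,k,i)$ be the number of directed paths in $\Gamma$ from the vertex $(i,0)$ to the vertex $(n,k)$ (a path of length zero counting when the two vertices coincide). Let $E_m$ denote the number of down-up permutations of $\{1,\ldots,m\}$, with $E_0=1$. Then for all $0\le k\le n$, $$\pi(n,n,k)=\binom{n}{k}E_{n-k}.$$
   Context: A permutation $(p_1,\ldots,p_m)$ of $\{1,\ldots,m\}$ is down-up if $p_1>p_2<p_3>p_4<\cdots$ (alternately falling and rising, starting with a fall). -}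

module Defs where

open import Data.Nat using (ℕ; zero; suc; _≤_; _∸_; _<ᵇ_)
open import Data.Product using (_×_; _,_)
open import Data.Bool using (Bool; true; false; not; _∧_; T; if_then_else_)
open import Data.Fin using (Fin; toℕ)
open import Data.Fin.Properties using () renaming (_≟_ to _≟F_)
open import Data.Vec using (Vec; []; _∷_; toList)
open import Data.List using (List; []; _∷_; [_]; map; concatMap; length; filter; allFin)
open import Data.List.Relation.Unary.Unique.Propositional using (Unique)
import Data.List.Relation.Unary.Unique.DecPropositional as UDec
open import Relation.Nullary.Decidable using (_×-dec_; T?)

Vertex : Set
Vertex = ℕ × ℕ

ValidVertex : Vertex → Set
ValidVertex (n , k) = k ≤ n

data Edge : Vertex → Vertex → Set where
  horiz : ∀ {n k} → k ≤ n → Edge (suc n , k) (suc n , suc k)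
  jump  : ∀ {n k} → k ≤ n → Edge (n , n ∸ k) (suc n , suc k)

data Walk : Vertex → Vertex → List Vertex → Set where
  stop : ∀ {u} → ValidVertex u → Walk u u (u ∷ [])
  step : ∀ {u w v ws} → Edge u w → Walk w v ws → Walk u v (u ∷ ws)

IsPath : Vertex → Vertex → List Vertex → Set
IsPath u v p = Walk u v p × Unique p

allVecs : (m len : ℕ) → List (Vec (Fin m) len)
allVecs m zero = [ [] ]
allVecs m (suc len) = concatMap (λ x → map (x ∷_) (allVecs m len)) (allFin m)

alt : Bool → List ℕ → Bool
alt down (x ∷ y ∷ rest) = (if down then y <ᵇ x else x <ᵇ y) ∧ alt (not down) (y ∷ rest)
alt down _ = true

-- A permutation of {1,…,m} is encoded (order-preservingly, shifted by one)
-- as its one-line notation: a vector of length m over Fin m with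
-- pairwise distinct entries.
IsPermutation : {m : ℕ} → Vec (Fin m) m → Set
IsPermutation v = Unique (toList v)

IsDownUp : {m : ℕ} → Vec (Fin m) m → Set
IsDownUp v = T (alt true (map toℕ (toList v)))

E : ℕ → ℕ
E m = length (filter (λ v → UDec.unique? _≟F_ (toList v) ×-dec T? (alt true (map toℕ (toList v))))
                     (allVecs m m))

{-# OPTIONS --safe #-}
module Submission where

-- Write π′ i a b for the number of paths from (i , 0) to (a + b , a). Splitting a path by its
-- last edge gives the boustrophedon recurrence π′ i (a + 1) b = π′ i a (b + 1) + π′ i b a, with
-- π′ i 0 b = [b = i]. The operator ∂ f a b = a f (a - 1) b + b f a (b - 1) preserves this
-- recurrence and sends the initial values of π′ i to (i + 1) times those of π′ (i + 1), so
-- (i + 1) π′ (i + 1) = ∂ (π′ i). At b = 0 this reads (i + 1) π′ (i + 1) (a + 1) 0 = (a + 1) π′ i a 0,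
-- which iterates to π′ i (i + m) 0 = C(i + m, i) π′ 0 m 0. Finally π′ 0 are the Entringer numbers:
-- choosing the entries of a down-up permutation one at a time, the number of completions depends
-- only on how many unused values lie below and above the last entry, and these counts obey the
-- same recurrence, whence E m = π′ 0 m 0.

open import Defs
open import Algebra.Bundles using (CommutativeMonoid)
open import Data.Bool.Base using (Bool; true; false; not; _∧_; if_then_else_; T)
open import Data.Bool.ListAction using (all)
open import Data.Bool.Properties
  using (∧-zeroʳ; ∧-identityʳ; ∧-conicalˡ; ∧-conicalʳ; ∧-commutativeMonoid; T-≡)
open import Data.Fin.Base using (Fin; toℕ; zero; suc)
open import Data.Fin.Properties using () renaming (_≟_ to _≟F_)
open import Data.List.Base
  using (List; []; _∷_; [_]; _++_; _∷ʳ_; map; concatMap; length; last; filter; allFin; tabulate)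
open import Data.List.Properties using (length-++; length-map; ∷ʳ-injectiveˡ; map-cong; map-tabulate)
open import Data.List.Membership.Propositional using (_∈_)
open import Data.List.Membership.Propositional.Properties
  using (∈-++⁻; ∈-++⁺ˡ; ∈-++⁺ʳ; ∈-map⁻; ∈-map⁺)
open import Data.List.Relation.Unary.All as All using (All; []; _∷_)
open import Data.List.Relation.Unary.AllPairs using ([]; _∷_)
open import Data.List.Relation.Unary.Any using (here)
open import Data.List.Relation.Unary.Unique.Propositional using (Unique)
import Data.List.Relation.Unary.Unique.Propositional.Properties as Unique
import Data.List.Relation.Unary.Unique.DecPropositional as UniqueDec
open import Data.Maybe.Base using (just)
open import Data.Maybe.Properties using (just-injective)
open import Data.Nat.Base
open import Data.Nat.Combinatorics using (_C_; nC1≡n; nCk+nC[k+1]≡[n+1]C[k+1])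
open import Data.Nat.ListAction using (sum)
open import Data.Nat.Properties
open import Data.Nat.Tactic.RingSolver using (solve-∀)
open import Data.Product.Base using (Σ; _×_; _,_; proj₁)
open import Data.Sum.Base using (inj₁; inj₂; [_,_]′)
open import Data.Vec.Base using (Vec; _∷_; toList)
open import Function.Base using (_∘_)
open import Function.Bundles using (Equivalence; _⇔_; mk⇔)
open import Relation.Binary.PropositionalEquality
  using (_≡_; _≢_; refl; sym; trans; cong; cong₂; subst; module ≡-Reasoning)
open import Relation.Nullary using (¬_; Dec; does; yes; no; contradiction)
open import Relation.Nullary.Decidable using (_×-dec_; T?; ¬?)
open import Relation.Unary using (Decidable)

open import Algebra.Properties.CommutativeSemigroup +-commutativeSemigroup
  using () renaming (interchange to +-interchange)
open import Algebra.Properties.CommutativeSemigroup (CommutativeMonoid.commutativeSemigroup ∧-commutativeMonoid)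
  using () renaming (interchange to ∧-interchange)
open import Algebra.Solver.CommutativeMonoid ∧-commutativeMonoid
  using (_⊜_; _⊕_) renaming (solve to ∧-solve)

T⇒≡true : ∀ {b} → T b → b ≡ true
T⇒≡true = Equivalence.to T-≡

≡true⇒T : ∀ {b} → b ≡ true → T b
≡true⇒T = Equivalence.from T-≡

≡ᵇ-refl : ∀ n → (n ≡ᵇ n) ≡ true
≡ᵇ-refl n = T⇒≡true (≡⇒≡ᵇ n n refl)

≡ᵇ-sym : ∀ m n → (m ≡ᵇ n) ≡ (n ≡ᵇ m)
≡ᵇ-sym zero    zero    = refl
≡ᵇ-sym zero    (suc n) = refl
≡ᵇ-sym (suc m) zero    = refl
≡ᵇ-sym (suc m) (suc n) = ≡ᵇ-sym m n

≢⇒≡ᵇ-false : ∀ {m n} → m ≢ n → (m ≡ᵇ n) ≡ false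
≢⇒≡ᵇ-false {m} {n} m≢n with m ≡ᵇ n in m≡ᵇn
... | true  = contradiction (≡ᵇ⇒≡ m n (≡true⇒T m≡ᵇn)) m≢n
... | false = refl

<⇒<ᵇ-true : ∀ {m n} → m < n → (m <ᵇ n) ≡ true
<⇒<ᵇ-true m<n = T⇒≡true (<⇒<ᵇ m<n)

<ᵇ-true⇒< : ∀ {m n} → (m <ᵇ n) ≡ true → m < n
<ᵇ-true⇒< {m} {n} m<ᵇn = <ᵇ⇒< m n (≡true⇒T m<ᵇn)

≥⇒<ᵇ-false : ∀ {m n} → n ≤ m → (m <ᵇ n) ≡ false
≥⇒<ᵇ-false {m} {n} n≤m with m <ᵇ n in m<ᵇn
... | true  = contradiction n≤m (<⇒≱ (<ᵇ-true⇒< m<ᵇn))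
... | false = refl

≢⇒not-<ᵇ : ∀ {m n} → m ≢ n → not (m <ᵇ n) ≡ (n <ᵇ m)
≢⇒not-<ᵇ {zero}  {zero}  0≢0 = contradiction refl 0≢0
≢⇒not-<ᵇ {zero}  {suc n} _   = refl
≢⇒not-<ᵇ {suc m} {zero}  _   = refl
≢⇒not-<ᵇ {suc m} {suc n} m≢n = ≢⇒not-<ᵇ (m≢n ∘ cong suc)

if-cong : ∀ c {x y : ℕ} → (c ≡ true → x ≡ y) → (if c then x else 0) ≡ (if c then y else 0)
if-cong true  x≡y = x≡y refl
if-cong false x≡y = refl

-- Sums and counts over an initial segment of ℕ

sumBelow : ℕ → (ℕ → ℕ) → ℕ
sumBelow zero    f = 0
sumBelow (suc n) f = sumBelow n f + f n

sumBelow-cong : ∀ n {f g} → (∀ i → i < n → f i ≡ g i) → sumBelow n f ≡ sumBelow n g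
sumBelow-cong zero    f≗g = refl
sumBelow-cong (suc n) f≗g = cong₂ _+_ (sumBelow-cong n (λ i i<n → f≗g i (m<n⇒m<1+n i<n))) (f≗g n (n<1+n n))

sumBelow-distrib-+ : ∀ n (f g : ℕ → ℕ) → sumBelow n (λ i → f i + g i) ≡ sumBelow n f + sumBelow n g
sumBelow-distrib-+ zero    f g = refl
sumBelow-distrib-+ (suc n) f g = trans (cong (_+ (f n + g n)) (sumBelow-distrib-+ n f g))
                                       (+-interchange (sumBelow n f) (sumBelow n g) (f n) (g n))

sumBelow-suc : ∀ n (f : ℕ → ℕ) → sumBelow (suc n) f ≡ f 0 + sumBelow n (λ i → f (suc i))
sumBelow-suc zero    f = +-comm 0 (f 0)
sumBelow-suc (suc n) f = trans (cong (_+ f (suc n)) (sumBelow-suc n f)) (+-assoc (f 0) _ _)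

indicator : Bool → ℕ
indicator b = if b then 1 else 0

countBelow : ℕ → (ℕ → Bool) → ℕ
countBelow b S = sumBelow b (λ z → indicator (S z))

countBelow-cong : ∀ b {S S′} → (∀ z → z < b → S z ≡ S′ z) → countBelow b S ≡ countBelow b S′
countBelow-cong b S≗S′ = sumBelow-cong b (λ z z<b → cong indicator (S≗S′ z z<b))

countBelow-true : ∀ b → countBelow b (λ _ → true) ≡ b
countBelow-true zero    = refl
countBelow-true (suc b) = trans (cong (_+ 1) (countBelow-true b)) (+-comm b 1)

sumBelow-rank : ∀ b (S : ℕ → Bool) (g : ℕ → ℕ) →
                sumBelow b (λ y → if S y then g (countBelow y S) else 0) ≡ sumBelow (countBelow b S) g
sumBelow-rank zero    S g = refl
sumBelow-rank (suc b) S g with S b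
... | true  = trans (cong (_+ g (countBelow b S)) (sumBelow-rank b S g))
                    (cong (λ n → sumBelow n g) (+-comm 1 (countBelow b S)))
... | false = trans (+-identityʳ (sumBelow b (λ y → if S y then g (countBelow y S) else 0)))
                    (trans (sumBelow-rank b S g) (cong (λ n → sumBelow n g) (sym (+-identityʳ (countBelow b S)))))

countBelow-split : ∀ b (S P : ℕ → Bool) →
                   countBelow b S ≡ countBelow b (λ z → S z ∧ P z) + countBelow b (λ z → S z ∧ not (P z))
countBelow-split b S P = trans (sumBelow-cong b (λ z _ → split (S z) (P z)))
                               (sumBelow-distrib-+ b (λ z → indicator (S z ∧ P z))
                                                     (λ z → indicator (S z ∧ not (P z))))
  where
  split : ∀ s p → indicator s ≡ indicator (s ∧ p) + indicator (s ∧ not p)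
  split false p     = refl
  split true  true  = refl
  split true  false = refl

countBelow-∧<ᵇ-≤ : ∀ b c (S : ℕ → Bool) → b ≤ c →
                   countBelow b (λ z → S z ∧ (z <ᵇ c)) ≡ countBelow b S
countBelow-∧<ᵇ-≤ b c S b≤c = countBelow-cong b (λ z z<b →
  trans (cong (S z ∧_) (<⇒<ᵇ-true (<-≤-trans z<b b≤c))) (∧-identityʳ (S z)))

countBelow-∧<ᵇ-≥ : ∀ b c (S : ℕ → Bool) → c ≤ b →
                   countBelow b (λ z → S z ∧ (z <ᵇ c)) ≡ countBelow c S
countBelow-∧<ᵇ-≥ b c S c≤b with m≤n⇒m<n∨m≡n c≤b
... | inj₂ refl = countBelow-∧<ᵇ-≤ b b S ≤-refl
countBelow-∧<ᵇ-≥ (suc b) c S _ | inj₁ c<1+b = begin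
    countBelow b (λ z → S z ∧ (z <ᵇ c)) + indicator (S b ∧ (b <ᵇ c))
  ≡⟨ cong₂ _+_ (countBelow-∧<ᵇ-≥ b c S (≤-pred c<1+b))
               (cong indicator (trans (cong (S b ∧_) (≥⇒<ᵇ-false (≤-pred c<1+b))) (∧-zeroʳ (S b)))) ⟩
    countBelow c S + 0
  ≡⟨ +-identityʳ (countBelow c S) ⟩
    countBelow c S
  ∎
  where open ≡-Reasoning

countBelow-split-at : ∀ b t (S : ℕ → Bool) → t ≤ b → S t ≡ false →
                      countBelow b S ≡ countBelow t S + countBelow b (λ z → S z ∧ (t <ᵇ z))
countBelow-split-at b t S t≤b St≡false = begin
    countBelow b S
  ≡⟨ countBelow-split b S (_<ᵇ t) ⟩
    countBelow b (λ z → S z ∧ (z <ᵇ t)) + countBelow b (λ z → S z ∧ not (z <ᵇ t))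
  ≡⟨ cong₂ _+_ (countBelow-∧<ᵇ-≥ b t S t≤b) (countBelow-cong b (λ z _ → not-below z)) ⟩
    countBelow t S + countBelow b (λ z → S z ∧ (t <ᵇ z))
  ∎
  where
  open ≡-Reasoning
  not-below : ∀ z → S z ∧ not (z <ᵇ t) ≡ S z ∧ (t <ᵇ z)
  not-below z with z ≟ t
  ... | yes refl rewrite St≡false = refl
  ... | no  z≢t  = cong (S z ∧_) (≢⇒not-<ᵇ z≢t)

countBelow-remove : ∀ b y (S : ℕ → Bool) → y < b → S y ≡ true →
                    countBelow b S ≡ suc (countBelow b (λ z → not (z ≡ᵇ y) ∧ S z))
countBelow-remove (suc b) y S y<1+b Sy≡true with m≤n⇒m<n∨m≡n (≤-pred y<1+b)
... | inj₁ y<b rewrite ≢⇒≡ᵇ-false (<⇒≢ y<b ∘ sym) =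
  cong (_+ indicator (S b)) (countBelow-remove b y S y<b Sy≡true)
... | inj₂ refl rewrite Sy≡true | ≡ᵇ-refl y = begin
    countBelow y S + 1
  ≡⟨ +-comm (countBelow y S) 1 ⟩
    suc (countBelow y S)
  ≡⟨ cong suc (countBelow-cong y (λ z z<y →
       cong (λ b → not b ∧ S z) (sym (≢⇒≡ᵇ-false (<⇒≢ z<y))))) ⟩
    suc (countBelow y (λ z → not (z ≡ᵇ y) ∧ S z))
  ≡⟨ cong suc (+-identityʳ (countBelow y (λ z → not (z ≡ᵇ y) ∧ S z))) ⟨
    suc (countBelow y (λ z → not (z ≡ᵇ y) ∧ S z) + 0)
  ∎
  where open ≡-Reasoning

count : {A : Set} → (A → Bool) → List A → ℕ
count p []       = 0
count p (x ∷ xs) = indicator (p x) + count p xs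

length-filter : ∀ {A : Set} {P : A → Set} (P? : Decidable P) xs →
                length (filter P? xs) ≡ count (λ x → does (P? x)) xs
length-filter P? []       = refl
length-filter P? (x ∷ xs) with does (P? x)
... | true  = cong suc (length-filter P? xs)
... | false = length-filter P? xs

count-cong : ∀ {A : Set} {p q : A → Bool} → (∀ x → p x ≡ q x) → ∀ xs → count p xs ≡ count q xs
count-cong p≗q []       = refl
count-cong p≗q (x ∷ xs) = cong₂ _+_ (cong indicator (p≗q x)) (count-cong p≗q xs)

count-++ : ∀ {A : Set} (p : A → Bool) xs ys → count p (xs ++ ys) ≡ count p xs + count p ys
count-++ p []       ys = refl
count-++ p (x ∷ xs) ys = trans (cong (indicator (p x) +_) (count-++ p xs ys)) (sym (+-assoc (indicator (p x)) _ _))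

count-concatMap : ∀ {A B : Set} (p : B → Bool) (f : A → List B) xs →
                  count p (concatMap f xs) ≡ sum (map (λ x → count p (f x)) xs)
count-concatMap p f []       = refl
count-concatMap p f (x ∷ xs) =
  trans (count-++ p (f x) (concatMap f xs)) (cong (count p (f x) +_) (count-concatMap p f xs))

count-map : ∀ {A B : Set} (p : B → Bool) (f : A → B) xs → count p (map f xs) ≡ count (λ x → p (f x)) xs
count-map p f []       = refl
count-map p f (x ∷ xs) = cong (indicator (p (f x)) +_) (count-map p f xs)

count-∧ : ∀ {A : Set} c (p : A → Bool) xs → count (λ x → c ∧ p x) xs ≡ (if c then count p xs else 0)
count-∧ true  p xs       = refl
count-∧ false p []       = refl
count-∧ false p (x ∷ xs) = count-∧ false p xs

sum-allFin : ∀ m (f : ℕ → ℕ) → sum (map (λ x → f (toℕ x)) (allFin m)) ≡ sumBelow m f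
sum-allFin m f = trans (cong sum (map-tabulate {n = m} (λ x → x) (λ x → f (toℕ x)))) (sum-tabulate m f)
  where
  sum-tabulate : ∀ m (f : ℕ → ℕ) → sum (tabulate {n = m} (λ x → f (toℕ x))) ≡ sumBelow m f
  sum-tabulate zero    f = refl
  sum-tabulate (suc m) f = trans (cong (f 0 +_) (sum-tabulate m (λ i → f (suc i)))) (sym (sumBelow-suc m f))

count-allVecs-suc : ∀ m L (p : Vec (Fin m) (suc L) → Bool) (f : ℕ → ℕ) →
                    (∀ x → count (λ w → p (x ∷ w)) (allVecs m L) ≡ f (toℕ x)) →
                    count p (allVecs m (suc L)) ≡ sumBelow m f
count-allVecs-suc m L p f count≡f = begin
    count p (concatMap (λ x → map (x ∷_) (allVecs m L)) (allFin m))
  ≡⟨ count-concatMap p (λ x → map (x ∷_) (allVecs m L)) (allFin m) ⟩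
    sum (map (λ x → count p (map (x ∷_) (allVecs m L))) (allFin m))
  ≡⟨ cong sum (map-cong (λ x → trans (count-map p (x ∷_) (allVecs m L)) (count≡f x)) (allFin m)) ⟩
    sum (map (λ x → f (toℕ x)) (allFin m))
  ≡⟨ sum-allFin m f ⟩
    sumBelow m f
  ∎
  where open ≡-Reasoning

-- Binomial coefficients and the boustrophedon recurrence

[1+k]*[1+n]C[1+k]≡[1+n]*nCk : ∀ n k → suc k * (suc n C suc k) ≡ suc n * (n C k)
[1+k]*[1+n]C[1+k]≡[1+n]*nCk zero    zero    = refl
[1+k]*[1+n]C[1+k]≡[1+n]*nCk zero    (suc k) = *-zeroʳ (suc (suc k))
[1+k]*[1+n]C[1+k]≡[1+n]*nCk (suc n) zero    =
  trans (*-identityˡ _) (trans (nC1≡n (suc (suc n))) (sym (*-identityʳ _)))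
[1+k]*[1+n]C[1+k]≡[1+n]*nCk (suc n) (suc k) = begin
    suc (suc k) * (suc (suc n) C suc (suc k))
  ≡⟨ cong (suc (suc k) *_) (nCk+nC[k+1]≡[n+1]C[k+1] (suc n) (suc k)) ⟨
    suc (suc k) * (suc n C suc k + suc n C suc (suc k))
  ≡⟨ *-distribˡ-+ (suc (suc k)) (suc n C suc k) _ ⟩
    suc n C suc k + suc k * (suc n C suc k) + suc (suc k) * (suc n C suc (suc k))
  ≡⟨ cong₂ (λ x y → suc n C suc k + x + y) ([1+k]*[1+n]C[1+k]≡[1+n]*nCk n k)
                                            ([1+k]*[1+n]C[1+k]≡[1+n]*nCk n (suc k)) ⟩
    suc n C suc k + suc n * (n C k) + suc n * (n C suc k)
  ≡⟨ +-assoc (suc n C suc k) _ _ ⟩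
    suc n C suc k + (suc n * (n C k) + suc n * (n C suc k))
  ≡⟨ cong (suc n C suc k +_) (*-distribˡ-+ (suc n) (n C k) _) ⟨
    suc n C suc k + suc n * (n C k + n C suc k)
  ≡⟨ cong (λ x → suc n C suc k + suc n * x) (nCk+nC[k+1]≡[n+1]C[k+1] n k) ⟩
    suc (suc n) * (suc n C suc k)
  ∎
  where open ≡-Reasoning

Boustrophedon : (ℕ → ℕ → ℕ) → Set
Boustrophedon f = ∀ a b → f (suc a) b ≡ f a (suc b) + f b a

boustrophedon-unique : ∀ {f g} → Boustrophedon f → Boustrophedon g →
                       (∀ b → f 0 b ≡ g 0 b) → ∀ a b → f a b ≡ g a b
boustrophedon-unique {f} {g} f-rec g-rec f0≡g0 a b = go (a + b) a b refl
  where
  go : ∀ n a b → a + b ≡ n → f a b ≡ g a b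
  go n       zero    b _  = f0≡g0 b
  go (suc n) (suc a) b eq = begin
    f (suc a) b          ≡⟨ f-rec a b ⟩
    f a (suc b) + f b a  ≡⟨ cong₂ _+_ (go (suc n) a (suc b) (trans (+-suc a b) eq))
                                      (go n b a (trans (+-comm b a) (suc-injective eq))) ⟩
    g a (suc b) + g b a  ≡⟨ g-rec a b ⟨
    g (suc a) b          ∎
    where open ≡-Reasoning

*-boustrophedon : ∀ c {f} → Boustrophedon f → Boustrophedon (λ a b → c * f a b)
*-boustrophedon c f-rec a b = trans (cong (c *_) (f-rec a b)) (*-distribˡ-+ c _ _)

∂ : (ℕ → ℕ → ℕ) → ℕ → ℕ → ℕ
∂ f a b = a * f (a ∸ 1) b + b * f a (b ∸ 1)

∂-boustrophedon : ∀ {f} → Boustrophedon f → Boustrophedon (∂ f)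
∂-boustrophedon {f} f-rec a b = begin
    suc a * f a b + b * f (suc a) (b ∸ 1)
  ≡⟨ cong (suc a * f a b +_) (b*f-rec b) ⟩
    f a b + a * f a b + b * (f a b + f (b ∸ 1) a)
  ≡⟨ cong (λ x → f a b + x + b * (f a b + f (b ∸ 1) a)) (a*f-rec a) ⟩
    f a b + a * (f (a ∸ 1) (suc b) + f b (a ∸ 1)) + b * (f a b + f (b ∸ 1) a)
  ≡⟨ rearrange a b (f (a ∸ 1) (suc b)) (f b (a ∸ 1)) (f a b) (f (b ∸ 1) a) ⟩
    (a * f (a ∸ 1) (suc b) + suc b * f a b) + (b * f (b ∸ 1) a + a * f b (a ∸ 1))
  ∎
  where
  open ≡-Reasoning
  a*f-rec : ∀ a → a * f a b ≡ a * (f (a ∸ 1) (suc b) + f b (a ∸ 1))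
  a*f-rec zero    = refl
  a*f-rec (suc a) = cong (suc a *_) (f-rec a b)
  b*f-rec : ∀ b → b * f (suc a) (b ∸ 1) ≡ b * (f a b + f (b ∸ 1) a)
  b*f-rec zero    = refl
  b*f-rec (suc b) = cong (suc b *_) (f-rec a b)
  rearrange : ∀ a b x y z w → z + a * (x + y) + b * (z + w) ≡ (a * x + suc b * z) + (b * w + a * y)
  rearrange = solve-∀

-- Paths in Γ

weight : Vertex → ℕ
weight (n , k) = n * n + k

edge-weight : ∀ {u w} → Edge u w → weight u < weight w
edge-weight (horiz {n} {k} _) = +-monoʳ-< (suc n * suc n) (n<1+n k)
edge-weight (jump {n} {k} _) = begin-strict
    n * n + (n ∸ k)        ≤⟨ +-monoʳ-≤ (n * n) (m∸n≤m n k) ⟩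
    n * n + n              ≡⟨ +-comm (n * n) n ⟩
    n + n * n              ≡⟨ *-suc n n ⟨
    n * suc n              <⟨ s≤s (m≤n+m (n * suc n) n) ⟩
    suc n * suc n          ≤⟨ m≤m+n (suc n * suc n) (suc k) ⟩
    suc n * suc n + suc k  ∎
  where open ≤-Reasoning

edge-source : ∀ {u w} → Edge u w → ValidVertex u
edge-source (horiz k≤n)      = m≤n⇒m≤1+n k≤n
edge-source (jump {n} {k} _) = m∸n≤m n k

edge-target : ∀ {u w} → Edge u w → ValidVertex w
edge-target (horiz k≤n) = s≤s k≤n
edge-target (jump k≤n)  = s≤s k≤n

walk-weight-≥ : ∀ {u v p} → Walk u v p → All (λ x → weight u ≤ weight x) p
walk-weight-≥ (stop _)   = ≤-refl ∷ []
walk-weight-≥ (step e w) = ≤-refl ∷ All.map (≤-trans (<⇒≤ (edge-weight e))) (walk-weight-≥ w)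

walk-unique : ∀ {u v p} → Walk u v p → Unique p
walk-unique (stop _)   = [] ∷ []
walk-unique (step e w) = All.map (λ { w≤u refl → <⇒≱ (edge-weight e) w≤u }) (walk-weight-≥ w) ∷ walk-unique w

walk-last : ∀ {u v p} → Walk u v p → last p ≡ just v
walk-last (stop _)            = refl
walk-last (step _ (stop _))   = refl
walk-last (step _ (step e w)) = walk-last (step e w)

walk-target : ∀ {u u′ v v′ p} → Walk u v p → Walk u′ v′ p → v ≡ v′
walk-target w w′ = just-injective (trans (sym (walk-last w)) (walk-last w′))

walk-∷ʳ : ∀ {u w v p} → Walk u w p → Edge w v → Walk u v (p ∷ʳ v)
walk-∷ʳ (stop _)    e = step e (stop (edge-target e))
walk-∷ʳ (step e′ w) e = step e′ (walk-∷ʳ w e)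

data SnocWalk (u : Vertex) : Vertex → List Vertex → Set where
  []  : SnocWalk u u (u ∷ [])
  _▷_ : ∀ {w v p} → Walk u w p → Edge w v → SnocWalk u v (p ∷ʳ v)

snocView : ∀ {u v p} → Walk u v p → SnocWalk u v p
snocView (stop _) = []
snocView (step e w) with snocView w
... | []      = stop (edge-source e) ▷ e
... | w′ ▷ e′ = step e w′ ▷ e′

extendLast : ℕ → ℕ → List (List Vertex) → List (List Vertex)
extendLast n k qs = if k ≤ᵇ n then map (_∷ʳ (suc n , suc k)) qs else []

paths : ℕ → ℕ → ℕ → List (List Vertex)
paths i n       zero    = if n ≡ᵇ i then [ [ (i , 0) ] ] else []
paths i zero    (suc k) = []
paths i (suc n) (suc k) = extendLast n k (paths i (suc n) k ++ paths i n (n ∸ k))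

∈-extendLast⁻ : ∀ {n k p} qs → p ∈ extendLast n k qs →
                k ≤ n × Σ (List Vertex) λ q → q ∈ qs × p ≡ q ∷ʳ (suc n , suc k)
∈-extendLast⁻ {n} {k} qs p∈ with k ≤ᵇ n in k≤ᵇn
∈-extendLast⁻ {n} {k} qs p∈ | true = ≤ᵇ⇒≤ k n (≡true⇒T k≤ᵇn) , ∈-map⁻ _ p∈

∈-extendLast⁺ : ∀ {n k q qs} → k ≤ n → q ∈ qs → q ∷ʳ (suc n , suc k) ∈ extendLast n k qs
∈-extendLast⁺ k≤n q∈ rewrite T⇒≡true (≤⇒≤ᵇ k≤n) = ∈-map⁺ _ q∈

extendLast-unique : ∀ n k {qs} → Unique qs → Unique (extendLast n k qs)
extendLast-unique n k qs! with k ≤ᵇ n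
... | true  = Unique.map⁺ (∷ʳ-injectiveˡ _ _) qs!
... | false = []

paths-sound : ∀ i n k {p} → p ∈ paths i n k → Walk (i , 0) (n , k) p
paths-sound i n zero p∈ with n ≡ᵇ i in n≡ᵇi
paths-sound i n zero (here refl) | true rewrite ≡ᵇ⇒≡ n i (≡true⇒T n≡ᵇi) = stop z≤n
paths-sound i (suc n) (suc k) p∈ =
  let k≤n , q , q∈ , p≡q∷ʳv = ∈-extendLast⁻ (paths i (suc n) k ++ paths i n (n ∸ k)) p∈ in
  subst (Walk (i , 0) (suc n , suc k)) (sym p≡q∷ʳv)
    ([ (λ q∈horiz → walk-∷ʳ (paths-sound i (suc n) k q∈horiz) (horiz k≤n))
     , (λ q∈jump  → walk-∷ʳ (paths-sound i n (n ∸ k) q∈jump) (jump k≤n))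
     ]′ (∈-++⁻ (paths i (suc n) k) q∈))

snocWalk-complete : ∀ i n k {p} → SnocWalk (i , 0) (n , k) p → p ∈ paths i n k
snocWalk-complete i _ zero [] rewrite ≡ᵇ-refl i = here refl
snocWalk-complete i (suc n) (suc k) (w ▷ horiz k≤n) =
  ∈-extendLast⁺ k≤n (∈-++⁺ˡ (snocWalk-complete i (suc n) k (snocView w)))
snocWalk-complete i (suc n) (suc k) (w ▷ jump k≤n) =
  ∈-extendLast⁺ k≤n (∈-++⁺ʳ (paths i (suc n) k) (snocWalk-complete i n (n ∸ k) (snocView w)))

∈-paths⇔IsPath : ∀ i n k p → (p ∈ paths i n k) ⇔ IsPath (i , 0) (n , k) p
∈-paths⇔IsPath i n k p = mk⇔ (λ p∈ → let w = paths-sound i n k p∈ in w , walk-unique w)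
                              (λ (w , _) → snocWalk-complete i n k (snocView w))

paths-unique : ∀ i n k → Unique (paths i n k)
paths-unique i n zero with n ≡ᵇ i
... | true  = [] ∷ []
... | false = []
paths-unique i zero    (suc k) = []
paths-unique i (suc n) (suc k) =
  extendLast-unique n k (Unique.++⁺ (paths-unique i (suc n) k) (paths-unique i n (n ∸ k)) disjoint)
  where
  disjoint : ∀ {q} → ¬ (q ∈ paths i (suc n) k × q ∈ paths i n (n ∸ k))
  disjoint (q∈horiz , q∈jump) =
    1+n≢n (cong proj₁ (walk-target (paths-sound i (suc n) k q∈horiz) (paths-sound i n (n ∸ k) q∈jump)))

-- π i n k is the paper's π(n, k, i).
π : ℕ → ℕ → ℕ → ℕ
π i n k = length (paths i n k)

π-suc-suc : ∀ i {n k} → k ≤ n → π i (suc n) (suc k) ≡ π i (suc n) k + π i n (n ∸ k)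
π-suc-suc i {n} {k} k≤n rewrite T⇒≡true (≤⇒≤ᵇ k≤n) =
  trans (length-map _ (paths i (suc n) k ++ paths i n (n ∸ k))) (length-++ (paths i (suc n) k))

π′ : ℕ → ℕ → ℕ → ℕ
π′ i a b = π i (a + b) a

π′-boustrophedon : ∀ i → Boustrophedon (π′ i)
π′-boustrophedon i a b = begin
    π i (suc (a + b)) (suc a)                      ≡⟨ π-suc-suc i (m≤m+n a b) ⟩
    π i (suc (a + b)) a + π i (a + b) (a + b ∸ a)  ≡⟨ cong₂ _+_ (cong (λ n → π i n a) (sym (+-suc a b)))
                                                               (cong₂ (π i) (+-comm a b) (m+n∸m≡n a b)) ⟩
    π i (a + suc b) a + π i (b + a) b              ∎
  where open ≡-Reasoning

π′-source-suc₀ : ∀ i b → suc i * π′ (suc i) 0 b ≡ ∂ (π′ i) 0 b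
π′-source-suc₀ i zero = *-zeroʳ (suc i)
π′-source-suc₀ i (suc b) with b ≡ᵇ i in b≡ᵇi
... | true rewrite ≡ᵇ⇒≡ b i (≡true⇒T b≡ᵇi) = refl
... | false = trans (*-zeroʳ (suc i)) (sym (*-zeroʳ (suc b)))

π′-source-suc : ∀ i a b → suc i * π′ (suc i) a b ≡ ∂ (π′ i) a b
π′-source-suc i = boustrophedon-unique (*-boustrophedon (suc i) {π′ (suc i)} (π′-boustrophedon (suc i)))
                                       (∂-boustrophedon (π′-boustrophedon i)) (π′-source-suc₀ i)

π′-diagonal : ∀ i m → π′ i (i + m) 0 ≡ ((i + m) C i) * π′ 0 m 0
π′-diagonal zero    m = sym (*-identityˡ (π′ 0 m 0))
π′-diagonal (suc i) m = *-cancelˡ-≡ _ _ (suc i) (begin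
    suc i * π′ (suc i) (suc (i + m)) 0
  ≡⟨ π′-source-suc i (suc (i + m)) 0 ⟩
    suc (i + m) * π′ i (i + m) 0 + 0
  ≡⟨ +-identityʳ _ ⟩
    suc (i + m) * π′ i (i + m) 0
  ≡⟨ cong (suc (i + m) *_) (π′-diagonal i m) ⟩
    suc (i + m) * (((i + m) C i) * π′ 0 m 0)
  ≡⟨ *-assoc (suc (i + m)) ((i + m) C i) (π′ 0 m 0) ⟨
    suc (i + m) * ((i + m) C i) * π′ 0 m 0
  ≡⟨ cong (_* π′ 0 m 0) ([1+k]*[1+n]C[1+k]≡[1+n]*nCk (i + m) i) ⟨
    suc i * (suc (i + m) C suc i) * π′ 0 m 0
  ≡⟨ *-assoc (suc i) (suc (i + m) C suc i) (π′ 0 m 0) ⟩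
    suc i * ((suc (i + m) C suc i) * π′ 0 m 0)
  ∎)
  where open ≡-Reasoning

-- Down-up permutations

_∉ᵇ_ : ℕ → List ℕ → Bool
x ∉ᵇ ys = all (λ y → not (x ≡ᵇ y)) ys

distinctᵇ : List ℕ → Bool
distinctᵇ []       = true
distinctᵇ (x ∷ xs) = x ∉ᵇ xs ∧ distinctᵇ xs

moves : Bool → ℕ → ℕ → Bool
moves d t y = if d then y <ᵇ t else t <ᵇ y

continues : Bool → List ℕ → ℕ → List ℕ → Bool
continues d V t []       = true
continues d V t (y ∷ ns) = (y ∉ᵇ V ∧ moves d t y) ∧ continues (not d) (y ∷ V) y ns

all-∉ᵇ-∷ : ∀ y V ns → all (_∉ᵇ (y ∷ V)) ns ≡ y ∉ᵇ ns ∧ all (_∉ᵇ V) ns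
all-∉ᵇ-∷ y V []       = refl
all-∉ᵇ-∷ y V (z ∷ ns) rewrite all-∉ᵇ-∷ y V ns | ≡ᵇ-sym z y =
  ∧-interchange (not (y ≡ᵇ z)) (z ∉ᵇ V) (y ∉ᵇ ns) (all (_∉ᵇ V) ns)

all-∉ᵇ-[_] : ∀ y ns → all (_∉ᵇ [ y ]) ns ≡ y ∉ᵇ ns
all-∉ᵇ-[ y ] ns =
  trans (all-∉ᵇ-∷ y [] ns) (trans (cong (y ∉ᵇ ns ∧_) (all-true ns)) (∧-identityʳ (y ∉ᵇ ns)))
  where
  all-true : ∀ ns → all (_∉ᵇ []) ns ≡ true
  all-true []       = refl
  all-true (_ ∷ ns) = all-true ns

continues-spec : ∀ d V t ns → continues d V t ns ≡ (all (_∉ᵇ V) ns ∧ distinctᵇ ns) ∧ alt d (t ∷ ns)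
continues-spec d V t []       = refl
continues-spec d V t (y ∷ ns) = begin
    (y ∉ᵇ V ∧ moves d t y) ∧ continues (not d) (y ∷ V) y ns
  ≡⟨ cong ((y ∉ᵇ V ∧ moves d t y) ∧_) (continues-spec (not d) (y ∷ V) y ns) ⟩
    (y ∉ᵇ V ∧ moves d t y) ∧ ((all (_∉ᵇ (y ∷ V)) ns ∧ distinctᵇ ns) ∧ alt (not d) (y ∷ ns))
  ≡⟨ cong (λ b → (y ∉ᵇ V ∧ moves d t y) ∧ ((b ∧ distinctᵇ ns) ∧ alt (not d) (y ∷ ns)))
          (all-∉ᵇ-∷ y V ns) ⟩
    (y ∉ᵇ V ∧ moves d t y) ∧ (((y ∉ᵇ ns ∧ all (_∉ᵇ V) ns) ∧ distinctᵇ ns) ∧ alt (not d) (y ∷ ns))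
  ≡⟨ rearrange (y ∉ᵇ V) (all (_∉ᵇ V) ns) (y ∉ᵇ ns) (distinctᵇ ns)
                (moves d t y) (alt (not d) (y ∷ ns)) ⟩
    ((y ∉ᵇ V ∧ all (_∉ᵇ V) ns) ∧ (y ∉ᵇ ns ∧ distinctᵇ ns)) ∧ (moves d t y ∧ alt (not d) (y ∷ ns))
  ∎
  where
  open ≡-Reasoning
  rearrange : ∀ a b c e m f → (a ∧ m) ∧ (((c ∧ b) ∧ e) ∧ f) ≡ ((a ∧ b) ∧ (c ∧ e)) ∧ (m ∧ f)
  rearrange = ∧-solve 6 (λ a b c e m f →
    (a ⊕ m) ⊕ (((c ⊕ b) ⊕ e) ⊕ f) ⊜ ((a ⊕ b) ⊕ (c ⊕ e)) ⊕ (m ⊕ f)) refl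

toℕs : ∀ {m L} → Vec (Fin m) L → List ℕ
toℕs w = map toℕ (toList w)

≟-does : ∀ {m} (x y : Fin m) → does (x ≟F y) ≡ (toℕ x ≡ᵇ toℕ y)
≟-does zero    zero    = refl
≟-does zero    (suc y) = refl
≟-does (suc x) zero    = refl
≟-does (suc x) (suc y) = ≟-does x y

unique?-does : ∀ {m} (xs : List (Fin m)) → does (UniqueDec.unique? _≟F_ xs) ≡ distinctᵇ (map toℕ xs)
unique?-does []       = refl
unique?-does (x ∷ xs) = cong₂ _∧_ (all?-does xs) (unique?-does xs)
  where
  all?-does : ∀ xs → does (All.all? (λ y → ¬? (x ≟F y)) xs) ≡ toℕ x ∉ᵇ map toℕ xs
  all?-does []       = refl
  all?-does (y ∷ xs) = cong₂ (λ b c → not b ∧ c) (≟-does x y) (all?-does xs)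

downUp? : ∀ {m L} (v : Vec (Fin m) L) → Dec (Unique (toList v) × T (alt true (toℕs v)))
downUp? v = UniqueDec.unique? _≟F_ (toList v) ×-dec T? (alt true (toℕs v))

downUp?-does : ∀ {m L} (x : Fin m) (w : Vec (Fin m) L) →
               does (downUp? (x ∷ w)) ≡ continues true [ toℕ x ] (toℕ x) (toℕs w)
downUp?-does x w = begin
    does (UniqueDec.unique? _≟F_ (x ∷ toList w)) ∧ alt true (toℕ x ∷ toℕs w)
  ≡⟨ cong (_∧ alt true (toℕ x ∷ toℕs w)) (unique?-does (x ∷ toList w)) ⟩
    (toℕ x ∉ᵇ toℕs w ∧ distinctᵇ (toℕs w)) ∧ alt true (toℕ x ∷ toℕs w)
  ≡⟨ cong (λ b → (b ∧ distinctᵇ (toℕs w)) ∧ alt true (toℕ x ∷ toℕs w))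
          (all-∉ᵇ-[ toℕ x ] (toℕs w)) ⟨
    (all (_∉ᵇ [ toℕ x ]) (toℕs w) ∧ distinctᵇ (toℕs w)) ∧ alt true (toℕ x ∷ toℕs w)
  ≡⟨ continues-spec true [ toℕ x ] (toℕ x) (toℕs w) ⟨
    continues true [ toℕ x ] (toℕ x) (toℕs w)
  ∎
  where open ≡-Reasoning

continuations : ℕ → ℕ → Bool → List ℕ → ℕ → ℕ
continuations m L d V t = count (λ w → continues d V t (toℕs w)) (allVecs m L)

continuations-suc : ∀ m L d V t → continuations m (suc L) d V t ≡
  sumBelow m (λ y → if y ∉ᵇ V ∧ moves d t y then continuations m L (not d) (y ∷ V) y else 0)
continuations-suc m L d V t = count-allVecs-suc m L (λ w → continues d V t (toℕs w))
  (λ y → if y ∉ᵇ V ∧ moves d t y then continuations m L (not d) (y ∷ V) y else 0)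
  (λ x → count-∧ (toℕ x ∉ᵇ V ∧ moves d t (toℕ x))
                 (λ w → continues (not d) (toℕ x ∷ V) (toℕ x) (toℕs w)) (allVecs m L))

-- zigzag a N L d counts the ways to choose L more values, alternating and first downwards iff
-- d = true, from N unused values of which a lie below the current last value.
zigzag : ℕ → ℕ → ℕ → Bool → ℕ
zigzag a N zero    d     = 1
zigzag a N (suc L) true  = sumBelow a       (λ r → zigzag r       (N ∸ 1) L false)
zigzag a N (suc L) false = sumBelow (N ∸ a) (λ r → zigzag (a + r) (N ∸ 1) L true)

continuations≡zigzag : ∀ m L d t U → t < m →
  continuations m L d (t ∷ U) t ≡ zigzag (countBelow t (_∉ᵇ (t ∷ U))) (countBelow m (_∉ᵇ (t ∷ U))) L d
continuations≡zigzag m zero    d t U t<m = refl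
continuations≡zigzag m (suc L) d t U t<m = trans (continuations-suc m L d V t) (sum≡zigzag d)
  where
  open ≡-Reasoning
  V = t ∷ U
  S = _∉ᵇ V
  N = countBelow m S
  A = countBelow t S
  St≡false : S t ≡ false
  St≡false = cong (λ b → not b ∧ t ∉ᵇ U) (≡ᵇ-refl t)
  next : ∀ d′ y → y < m → S y ≡ true →
         continuations m L d′ (y ∷ V) y ≡ zigzag (countBelow y S) (N ∸ 1) L d′
  next d′ y y<m Sy≡true = trans (continuations≡zigzag m L d′ y V y<m) (cong₂ (λ a N′ → zigzag a N′ L d′)
    (countBelow-cong y (λ z z<y → cong (λ b → not b ∧ S z) (≢⇒≡ᵇ-false (<⇒≢ z<y))))
    (sym (cong (_∸ 1) (countBelow-remove m y S y<m Sy≡true))))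
  sum≡zigzag : ∀ d → sumBelow m (λ y → if S y ∧ moves d t y then continuations m L (not d) (y ∷ V) y else 0)
                   ≡ zigzag A N (suc L) d
  sum≡zigzag true = begin
      sumBelow m (λ y → if S y ∧ (y <ᵇ t) then continuations m L false (y ∷ V) y else 0)
    ≡⟨ sumBelow-cong m (λ y y<m → if-cong (S y ∧ (y <ᵇ t)) λ e →
         trans (next false y y<m (∧-conicalˡ (S y) _ e))
               (cong g (sym (countBelow-∧<ᵇ-≤ y t S (<⇒≤ (<ᵇ-true⇒< (∧-conicalʳ (S y) _ e))))))) ⟩
      sumBelow m (λ y → if S y ∧ (y <ᵇ t) then g (countBelow y (λ z → S z ∧ (z <ᵇ t))) else 0)
    ≡⟨ sumBelow-rank m (λ z → S z ∧ (z <ᵇ t)) g ⟩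
      sumBelow (countBelow m (λ z → S z ∧ (z <ᵇ t))) g
    ≡⟨ cong (λ a → sumBelow a g) (countBelow-∧<ᵇ-≥ m t S (<⇒≤ t<m)) ⟩
      sumBelow A g
    ∎
    where
    g : ℕ → ℕ
    g r = zigzag r (N ∸ 1) L false
  sum≡zigzag false = begin
      sumBelow m (λ y → if S y ∧ (t <ᵇ y) then continuations m L true (y ∷ V) y else 0)
    ≡⟨ sumBelow-cong m (λ y y<m → if-cong (S y ∧ (t <ᵇ y)) λ e →
         trans (next true y y<m (∧-conicalˡ (S y) _ e))
               (cong g (countBelow-split-at y t S (<⇒≤ (<ᵇ-true⇒< (∧-conicalʳ (S y) _ e))) St≡false))) ⟩
      sumBelow m (λ y → if S y ∧ (t <ᵇ y) then g (A + countBelow y (λ z → S z ∧ (t <ᵇ z))) else 0)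
    ≡⟨ sumBelow-rank m (λ z → S z ∧ (t <ᵇ z)) (λ r → g (A + r)) ⟩
      sumBelow (countBelow m (λ z → S z ∧ (t <ᵇ z))) (λ r → g (A + r))
    ≡⟨ cong (λ c → sumBelow c (λ r → g (A + r))) above≡N∸A ⟩
      sumBelow (N ∸ A) (λ r → g (A + r))
    ∎
    where
    g : ℕ → ℕ
    g r = zigzag r (N ∸ 1) L true
    above≡N∸A : countBelow m (λ z → S z ∧ (t <ᵇ z)) ≡ N ∸ A
    above≡N∸A = sym (trans (cong (_∸ A) (countBelow-split-at m t S (<⇒≤ t<m) St≡false))
                           (m+n∸m≡n A (countBelow m (λ z → S z ∧ (t <ᵇ z)))))

zigzag-up-suc : ∀ a N L → a ≤ N →
                zigzag a (suc N) (suc L) false ≡ zigzag a N L true + zigzag (suc a) (suc N) (suc L) false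
zigzag-up-suc a N L a≤N = begin
    sumBelow (suc N ∸ a) (λ r → zigzag (a + r) N L true)
  ≡⟨ cong (λ c → sumBelow c (λ r → zigzag (a + r) N L true)) (+-∸-assoc 1 a≤N) ⟩
    sumBelow (suc (N ∸ a)) (λ r → zigzag (a + r) N L true)
  ≡⟨ sumBelow-suc (N ∸ a) (λ r → zigzag (a + r) N L true) ⟩
    zigzag (a + 0) N L true + sumBelow (N ∸ a) (λ r → zigzag (a + suc r) N L true)
  ≡⟨ cong₂ _+_ (cong (λ x → zigzag x N L true) (+-identityʳ a))
               (sumBelow-cong (N ∸ a) (λ r _ → cong (λ x → zigzag x N L true) (+-suc a r))) ⟩
    zigzag a N L true + sumBelow (N ∸ a) (λ r → zigzag (suc a + r) N L true)
  ∎
  where open ≡-Reasoning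

zigzag-down-diagonal : ∀ n a b → a + b ≡ n → zigzag a n n true  ≡ π′ 0 a b
zigzag-up-diagonal   : ∀ n a b → a + b ≡ n → zigzag a n n false ≡ π′ 0 b a

zigzag-down-diagonal zero    zero    zero     refl = refl
zigzag-down-diagonal (suc n) zero    .(suc n) refl = refl
zigzag-down-diagonal (suc n) (suc a) b        eq   = begin
    zigzag a (suc n) (suc n) true + zigzag a n n false
  ≡⟨ cong₂ _+_ (zigzag-down-diagonal (suc n) a (suc b) (trans (+-suc a b) eq))
               (zigzag-up-diagonal n a b (suc-injective eq)) ⟩
    π′ 0 a (suc b) + π′ 0 b a
  ≡⟨ π′-boustrophedon 0 a b ⟨
    π′ 0 (suc a) b
  ∎
  where open ≡-Reasoning

zigzag-up-diagonal zero    zero zero    refl = refl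
zigzag-up-diagonal (suc n) a    zero    eq with trans (sym (+-identityʳ a)) eq
... | refl = cong (λ c → sumBelow c (λ r → zigzag (suc n + r) n n true)) (n∸n≡0 n)
zigzag-up-diagonal (suc n) a    (suc b) eq = begin
    zigzag a (suc n) (suc n) false
  ≡⟨ zigzag-up-suc a n n (subst (a ≤_) a+b≡n (m≤m+n a b)) ⟩
    zigzag a n n true + zigzag (suc a) (suc n) (suc n) false
  ≡⟨ cong₂ _+_ (zigzag-down-diagonal n a b a+b≡n)
               (zigzag-up-diagonal (suc n) (suc a) b (trans (sym (+-suc a b)) eq)) ⟩
    π′ 0 a b + π′ 0 b (suc a)
  ≡⟨ +-comm (π′ 0 a b) (π′ 0 b (suc a)) ⟩
    π′ 0 b (suc a) + π′ 0 a b
  ≡⟨ π′-boustrophedon 0 b a ⟨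
    π′ 0 (suc b) a
  ∎
  where
  open ≡-Reasoning
  a+b≡n : a + b ≡ n
  a+b≡n = suc-injective (trans (sym (+-suc a b)) eq)

E-suc : ∀ m → E (suc m) ≡ sumBelow (suc m) (λ y → continuations (suc m) m true [ y ] y)
E-suc m = trans (length-filter downUp? (allVecs (suc m) (suc m)))
                (count-allVecs-suc (suc m) m (λ v → does (downUp? v)) (λ y → continuations (suc m) m true [ y ] y)
                                   (λ x → count-cong (downUp?-does x) (allVecs (suc m) m)))

E≡π′ : ∀ m → E m ≡ π′ 0 m 0
E≡π′ zero    = refl
E≡π′ (suc m) = begin
    E (suc m)
  ≡⟨ E-suc m ⟩
    sumBelow (suc m) (λ y → continuations (suc m) m true [ y ] y)
  ≡⟨ sumBelow-cong (suc m) (λ y y<1+m → trans (continuations≡zigzag (suc m) m true y [] y<1+m)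
                                              (cong₂ (λ a N → zigzag a N m true) (below y) (unused y y<1+m))) ⟩
    zigzag 0 (suc m) (suc m) false
  ≡⟨ zigzag-up-diagonal (suc m) 0 (suc m) refl ⟩
    π′ 0 (suc m) 0
  ∎
  where
  open ≡-Reasoning
  below : ∀ y → countBelow y (_∉ᵇ [ y ]) ≡ y
  below y = trans (countBelow-cong y (λ z z<y → cong (λ b → not b ∧ true) (≢⇒≡ᵇ-false (<⇒≢ z<y))))
                  (countBelow-true y)
  unused : ∀ y → y < suc m → countBelow (suc m) (_∉ᵇ [ y ]) ≡ m
  unused y y<1+m = sym (cong (_∸ 1) (trans (sym (countBelow-true (suc m)))
                                         (countBelow-remove (suc m) y (λ _ → true) y<1+m refl)))

proposition2 : (n k : ℕ) → k ≤ n →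
    Σ (List (List Vertex)) λ ps →
      Unique ps × (∀ p → (p ∈ ps) ⇔ IsPath (k , 0) (n , n) p)
        × length ps ≡ (n C k) * E (n ∸ k)
proposition2 n k k≤n = paths k n n , paths-unique k n n , ∈-paths⇔IsPath k n n , π-diagonal
  where
  open ≡-Reasoning
  π-diagonal : π k n n ≡ (n C k) * E (n ∸ k)
  π-diagonal = begin
      π k n n
    ≡⟨ cong (λ x → π k x n) (+-identityʳ n) ⟨
      π′ k n 0
    ≡⟨ cong (λ x → π′ k x 0) (m+[n∸m]≡n k≤n) ⟨
      π′ k (k + (n ∸ k)) 0
    ≡⟨ π′-diagonal k (n ∸ k) ⟩
      ((k + (n ∸ k)) C k) * π′ 0 (n ∸ k) 0
    ≡⟨ cong₂ (λ x y → (x C k) * y) (m+[n∸m]≡n k≤n) (sym (E≡π′ (n ∸ k))) ⟩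
      (n C k) * E (n ∸ k)
    ∎
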